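{- Let $H=(V,E)$ be an oriented hypergraph, with integer coefficients, and let $\mathcal D:=\operatorname{Im}(\delta^0\circ\gamma_0\circ\partial_1)\subseteq C^1$. Then the map $C_1/\operatorname{Ker}\partial_1\to\mathcal D$, $[x]\mapsto \delta^0(\gamma_0(\partial_1 x))$, is a well-defined isomorphism.
   Context: An oriented hypergraph $H=(V,E)$ consists of a finite set $V$ and a set $E$ of ordered pairs $(A,B)$ of disjoint subsets of $V$, where $E$ never contains both $(A,B)$ and $(B,A)$. $C_0,C_1$ are the free $\mathbb Z$-modules with bases $V$, $E$. $\partial_1\colon C_1\to C_0$ is the linear extension of $(A,B)\mapsto\sum_{v\in B}v-\sum_{v\in A}v$. $C^0=\mathrm{Hom}(C_0,\mathbb Z)$, $C^1=\mathrm{Hom}(C_1,\mathbb Z)$, $\delta^0\colon C^0\to C^1$, $\varphi\mapsto\varphi\circ\partial_1$. $\gamma_0\colon C_0\to C^0$ is the isomorphism sending $v\in V$ to the homomorphism $C_0\to\mathbb Z$ that maps $v$ to $1$ and every other vertex to $0$. -}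

module Defs where

open import Data.Nat using (ℕ)
open import Data.Integer using (ℤ; _+_; _-_; _*_; 0ℤ; 1ℤ)
open import Data.Fin using (Fin)
open import Data.Fin.Subset using (Subset; _∈_; _∉_; inside; outside)
open import Data.Vec using (lookup)
open import Data.Product using (_×_; _,_; proj₁; proj₂; Σ; swap)
open import Data.Vec.Functional using (foldr)
open import Function.Definitions using (Injective)
open import Relation.Binary.PropositionalEquality using (_≡_; _≢_)

-- Oriented hypergraphs on the vertex set V = Fin n with m hyperedges.
-- The edge set E is given by an injective enumeration  edge : Fin m → E
-- (so E is a genuine set of m distinct pairs (A , B)).

record OrientedHypergraph (n m : ℕ) : Set where
  field
    edge          : Fin m → Subset n × Subset n
    edge-injective : Injective _≡_ _≡_ edge
    disjoint      : ∀ e (v : Fin n) → v ∈ proj₁ (edge e) → v ∉ proj₂ (edge e)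
    no-reverse    : ∀ e f → e ≢ f → edge f ≢ swap (edge e)

Σ[_] : ∀ {k} → (Fin k → ℤ) → ℤ
Σ[ f ] = foldr _+_ 0ℤ f

𝟙 : ∀ {n} → Subset n → Fin n → ℤ
𝟙 S v with lookup S v
... | inside  = 1ℤ
... | outside = 0ℤ

-- Chain groups: free ℤ-modules with bases V and E, as coordinate vectors.

C₀ : ℕ → Set
C₀ n = Fin n → ℤ

C₁ : ℕ → Set
C₁ m = Fin m → ℤ

-- Cochain groups C^k = Hom(C_k , ℤ), represented as functionals;
-- equality of cochains is equality of values on every chain.
C⁰ : ℕ → Set
C⁰ n = C₀ n → ℤ

C¹ : ℕ → Set
C¹ m = C₁ m → ℤ

_≈¹_ : ∀ {m} → C¹ m → C¹ m → Set
φ ≈¹ ψ = ∀ x → φ x ≡ ψ x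

_≈₀_ : ∀ {n} → C₀ n → C₀ n → Set
c ≈₀ d = ∀ v → c v ≡ d v

_+₁_ : ∀ {m} → C₁ m → C₁ m → C₁ m
(x +₁ y) e = x e + y e

_+¹_ : ∀ {m} → C¹ m → C¹ m → C¹ m
(φ +¹ ψ) x = φ x + ψ x

_-₁_ : ∀ {m} → C₁ m → C₁ m → C₁ m
(x -₁ y) e = x e - y e

module _ {n m : ℕ} (H : OrientedHypergraph n m) where
  open OrientedHypergraph H

  ∂edge : Fin m → C₀ n
  ∂edge e v = 𝟙 (proj₂ (edge e)) v - 𝟙 (proj₁ (edge e)) v

  ∂₁ : C₁ m → C₀ n
  ∂₁ x v = Σ[ (λ e → x e * ∂edge e v) ]

  δ⁰ : C⁰ n → C¹ m
  δ⁰ φ x = φ (∂₁ x)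

  Ker∂₁ : C₁ m → Set
  Ker∂₁ x = ∂₁ x ≈₀ (λ _ → 0ℤ)

-- γ₀ : C₀ → C⁰, linear extension of  v ↦ (v ↦ 1, w ↦ 0 for w ≠ v)
γ₀ : ∀ {n} → C₀ n → C⁰ n
γ₀ c d = Σ[ (λ v → c v * d v) ]

module _ {n m : ℕ} (H : OrientedHypergraph n m) where

  Φ : C₁ m → C¹ m
  Φ x = δ⁰ H (γ₀ (∂₁ H x))

  𝒟 : C¹ m → Set
  𝒟 ψ = Σ (C₁ m) (λ x → ψ ≈¹ Φ x)

  -- The map C₁/Ker ∂₁ → 𝒟, [x] ↦ Φ x, is a well-defined isomorphism.
  -- Quotients are not available, so C₁/Ker ∂₁ is modelled as C₁ with the
  -- equivalence x ~ y ⇔ x − y ∈ Ker ∂₁.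
  record InducedIsomorphism : Set where
    field
      well-defined : ∀ x y → Ker∂₁ H (x -₁ y) → Φ x ≈¹ Φ y
      lands-in-𝒟   : ∀ x → 𝒟 (Φ x)
      homomorphism : ∀ x y → Φ (x +₁ y) ≈¹ (Φ x +¹ Φ y)
      injective    : ∀ x y → Φ x ≈¹ Φ y → Ker∂₁ H (x -₁ y)
      surjective   : ∀ ψ → 𝒟 ψ → Σ (C₁ m) (λ x → ψ ≈¹ Φ x)

-- Φ x z = δ⁰ (γ₀ (∂₁ x)) z is the standard inner product ⟨∂₁ x , ∂₁ z⟩ on C₀,
-- so Φ is additive and Φ x depends only on ∂₁ x. Conversely, if Φ x = Φ y
-- then evaluating at z = x − y gives ⟨∂₁ (x − y) , ∂₁ (x − y)⟩ = 0, and
-- positive definiteness forces x − y ∈ Ker ∂₁.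
module Submission where

open import Defs
open import Data.Nat using (ℕ; zero; suc; z≤n)
open import Data.Integer using (ℤ; _+_; _-_; _*_; -_; 0ℤ; +_; -[1+_]; _≤_; +≤+; nonNegative)
open import Data.Integer.Properties
open import Data.Fin using (Fin; zero; suc)
open import Data.Product using (_,_)
open import Data.Sum using ([_,_]′)
open import Function using (id)
open import Relation.Binary.PropositionalEquality
open import Algebra.Properties.CommutativeMonoid.Sum +-0-commutativeMonoid
  using (sum-cong-≗; ∑-distrib-+)

Σ-neg : ∀ {k} (f : Fin k → ℤ) → Σ[ (λ i → - f i) ] ≡ - Σ[ f ]
Σ-neg {zero}  f = refl
Σ-neg {suc k} f = trans (cong (_+_ (- f zero)) (Σ-neg (λ i → f (suc i))))
                        (sym (neg-distrib-+ (f zero) _))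

Σ-nonneg : ∀ {k} (f : Fin k → ℤ) → (∀ i → 0ℤ ≤ f i) → 0ℤ ≤ Σ[ f ]
Σ-nonneg {zero}  f f≥0 = ≤-refl
Σ-nonneg {suc k} f f≥0 = +-mono-≤ (f≥0 zero) (Σ-nonneg (λ i → f (suc i)) (λ i → f≥0 (suc i)))

term≤Σ : ∀ {k} (f : Fin k → ℤ) → (∀ i → 0ℤ ≤ f i) → ∀ i → f i ≤ Σ[ f ]
term≤Σ f f≥0 zero    = i≤i+j (f zero) _
  {{nonNegative (Σ-nonneg (λ i → f (suc i)) (λ i → f≥0 (suc i)))}}
term≤Σ f f≥0 (suc i) = i≤j⇒i≤k+j (f zero) {{nonNegative (f≥0 zero)}}
  (term≤Σ (λ i → f (suc i)) (λ i → f≥0 (suc i)) i)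

Σ-nonneg≡0⇒≡0 : ∀ {k} (f : Fin k → ℤ) → (∀ i → 0ℤ ≤ f i) →
                Σ[ f ] ≡ 0ℤ → ∀ i → f i ≡ 0ℤ
Σ-nonneg≡0⇒≡0 f f≥0 Σf≡0 i = ≤-antisym (subst (f i ≤_) Σf≡0 (term≤Σ f f≥0 i)) (f≥0 i)

i*i≥0 : ∀ i → 0ℤ ≤ i * i
i*i≥0 (+ n)    = subst (0ℤ ≤_) (sym (+◃n≡+n _)) (+≤+ z≤n)
i*i≥0 -[1+ n ] = +≤+ z≤n

infix 7 _·_

_·_ : ∀ {k} → (Fin k → ℤ) → (Fin k → ℤ) → ℤ
a · c = Σ[ (λ i → a i * c i) ]

·-congˡ : ∀ {k} {a b : Fin k → ℤ} (c : Fin k → ℤ) → (∀ i → a i ≡ b i) → a · c ≡ b · c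
·-congˡ c a≗b = sum-cong-≗ (λ i → cong (_* c i) (a≗b i))

·-distribʳ-+ : ∀ {k} (a b c : Fin k → ℤ) → (a +₁ b) · c ≡ a · c + b · c
·-distribʳ-+ a b c = trans (sum-cong-≗ (λ i → *-distribʳ-+ (c i) (a i) (b i)))
                           (∑-distrib-+ (λ i → a i * c i) (λ i → b i * c i))

·-distribʳ-- : ∀ {k} (a b c : Fin k → ℤ) → (a -₁ b) · c ≡ a · c - b · c
·-distribʳ-- a b c = begin
  (a -₁ b) · c                         ≡⟨ ·-distribʳ-+ a (λ i → - b i) c ⟩
  a · c + Σ[ (λ i → - b i * c i) ]     ≡⟨ cong (_+_ (a · c)) (sum-cong-≗ (λ i → sym (neg-distribˡ-* (b i) (c i)))) ⟩
  a · c + Σ[ (λ i → - (b i * c i)) ]   ≡⟨ cong (_+_ (a · c)) (Σ-neg (λ i → b i * c i)) ⟩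
  a · c - b · c                        ∎
  where open ≡-Reasoning

·-self≡0⇒≡0 : ∀ {k} (a : Fin k → ℤ) → a · a ≡ 0ℤ → ∀ i → a i ≡ 0ℤ
·-self≡0⇒≡0 a a·a≡0 i =
  [ id , id ]′ (i*j≡0⇒i≡0∨j≡0 (a i) (Σ-nonneg≡0⇒≡0 _ (λ j → i*i≥0 (a j)) a·a≡0 i))

module _ {n m : ℕ} (H : OrientedHypergraph n m) where

  ∂₁-+ : ∀ x y v → ∂₁ H (x +₁ y) v ≡ ∂₁ H x v + ∂₁ H y v
  ∂₁-+ x y v = ·-distribʳ-+ x y (λ e → ∂edge H e v)

  ∂₁-- : ∀ x y v → ∂₁ H (x -₁ y) v ≡ ∂₁ H x v - ∂₁ H y v
  ∂₁-- x y v = ·-distribʳ-- x y (λ e → ∂edge H e v)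

  Ker∂₁[x-y]⇒∂₁x≈∂₁y : ∀ x y → Ker∂₁ H (x -₁ y) → ∂₁ H x ≈₀ ∂₁ H y
  Ker∂₁[x-y]⇒∂₁x≈∂₁y x y ker v = i-j≡0⇒i≡j _ _ (trans (sym (∂₁-- x y v)) (ker v))

proposition3 : ∀ {n m : ℕ} (H : OrientedHypergraph n m) → InducedIsomorphism H
proposition3 H = record
  { well-defined = λ x y ker z → ·-congˡ (∂₁ H z) (Ker∂₁[x-y]⇒∂₁x≈∂₁y H x y ker)
  ; lands-in-𝒟   = λ x → x , λ _ → refl
  ; homomorphism = λ x y z → trans (·-congˡ (∂₁ H z) (∂₁-+ H x y))
                                   (·-distribʳ-+ (∂₁ H x) (∂₁ H y) (∂₁ H z))
  ; injective    = λ x y Φx≈Φy → ·-self≡0⇒≡0 (∂₁ H (x -₁ y)) (∂₁[x-y]·∂₁[x-y]≡0 x y Φx≈Φy)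
  ; surjective   = λ ψ ψ∈𝒟 → ψ∈𝒟
  }
  where
  ∂₁[x-y]·∂₁[x-y]≡0 : ∀ x y → Φ H x ≈¹ Φ H y → ∂₁ H (x -₁ y) · ∂₁ H (x -₁ y) ≡ 0ℤ
  ∂₁[x-y]·∂₁[x-y]≡0 x y Φx≈Φy = begin
    ∂₁ H (x -₁ y) · d                     ≡⟨ ·-congˡ d (∂₁-- H x y) ⟩
    (∂₁ H x -₁ ∂₁ H y) · d                ≡⟨ ·-distribʳ-- (∂₁ H x) (∂₁ H y) d ⟩
    Φ H x (x -₁ y) - Φ H y (x -₁ y)       ≡⟨ i≡j⇒i-j≡0 (Φx≈Φy (x -₁ y)) ⟩
    0ℤ                                    ∎
    where
    open ≡-Reasoning
    d = ∂₁ H (x -₁ y)
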